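{- Consider the $2\times 2$ Rubik's square: the graph with twelve edges labelled $1,\dots,12$ (the edges of a $2\times 2$ grid of unit squares) and four distinguished $4$-cycles of edges $C_1=(1\,4\,6\,3)$, $C_2=(2\,5\,7\,4)$, $C_3=(6\,9\,11\,8)$, $C_4=(7\,10\,12\,9)$. A configuration is an assignment of one of four colors to each of the twelve edges such that each color is used on exactly three edges. A move $M_i$ ($i=1,\dots,4$) rotates the square bounded by $C_i$: it cyclically permutes the colors along the edges of $C_i$ in the cyclic order listed, leaving all other edges unchanged. Then the $2\times 2$ Rubik's square is complete: for any two configurations there exists a finite sequence of moves $M_1,\dots,M_4$ transforming the first configuration into the second.
   Context: Geometrically, the edges are: $1,2$ the top boundary (left, right); $3,8$ the left boundary (top, bottom); $5,10$ the right boundary (top, bottom); $11,12$ the bottom boundary (left, right); $4$ and $9$ the upper and lower halves of the central vertical segment; $6$ and $7$ the left and right halves of the central horizontal segment. Each $C_i$ is the boundary of one of the four small squares (top-left, top-right, bottom-left, bottom-right respectively). -}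

module Defs where

open import Data.Nat using (ℕ)
open import Data.Fin using (Fin; zero; suc; _≟_; #_)
open import Data.Fin.Patterns using (0F; 1F; 2F; 3F)
open import Data.List using (List; []; _∷_; filter; length; allFin)
open import Data.Product using (_×_; _,_)
open import Relation.Binary.PropositionalEquality using (_≡_)
open import Relation.Nullary using (yes; no)

-- Edges 1..12 are represented by Fin 12: edge k ↦ index k - 1.
Edge : Set
Edge = Fin 12

Color : Set
Color = Fin 4

Coloring : Set
Coloring = Edge → Color

count : Coloring → Color → ℕ
count f c = length (filter (λ e → f e ≟ c) (allFin 12))

IsConfiguration : Coloring → Set
IsConfiguration f = (c : Color) → count f c ≡ 3

record Cycle4 : Set where
  constructor cyc
  field
    e₁ e₂ e₃ e₄ : Edge

-- C1 = (1 4 6 3), C2 = (2 5 7 4), C3 = (6 9 11 8), C4 = (7 10 12 9)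
-- (edge k written as index k - 1)
C : Fin 4 → Cycle4
C 0F = cyc (# 0) (# 3) (# 5) (# 2)
C 1F = cyc (# 1) (# 4) (# 6) (# 3)
C 2F = cyc (# 5) (# 8) (# 10) (# 7)
C 3F = cyc (# 6) (# 9) (# 11) (# 8)

rotate : Cycle4 → Coloring → Coloring
rotate (cyc a b c d) f e with e ≟ a | e ≟ b | e ≟ c | e ≟ d
... | yes _ | _     | _     | _     = f d
... | no _  | yes _ | _     | _     = f a
... | no _  | no _  | yes _ | _     = f b
... | no _  | no _  | no _  | yes _ = f c
... | no _  | no _  | no _  | no _  = f e

move : Fin 4 → Coloring → Coloring
move i = rotate (C i)

applyMoves : List (Fin 4) → Coloring → Coloring
applyMoves []       f = f
applyMoves (m ∷ ms) f = applyMoves ms (move m f)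

-- The moves generate the full symmetric group on the twelve edges. For two squares
-- a, b sharing an edge, the word (a a b)⁴ b exchanges exactly two edges, and
-- conjugating these words by single moves yields the transposition of every pair of
-- consecutive edges k, k + 1. Adjacent transpositions realise every rearrangement of
-- a list, and two configurations use every color equally often, so the list of colors
-- of one is a rearrangement of the list of colors of the other.
module Submission where

open import Defs
open import Data.Bool using (true; false)
open import Data.Fin using (Fin; _≟_)
open import Data.Fin.Patterns using (0F; 1F; 2F; 3F)
open import Data.List using (List; []; _∷_; _++_; [_]; map; filter; length; allFin; concat; concatMap; replicate; reverse)
open import Data.List.Membership.Propositional using (_∈_)
open import Data.List.Membership.Propositional.Properties using (∈-∃++; ∈-allFin)
open import Data.List.Properties using (∷-injective)
open import Data.List.Relation.Binary.Permutation.Propositional as ↭ using (_↭_; refl; prep; swap; ↭-trans; ↭-sym)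
open import Data.List.Relation.Binary.Permutation.Propositional.Properties using (shift; filter-↭; ↭-length)
open import Data.List.Relation.Unary.Any using (here; there)
open import Data.Nat using (ℕ; zero; suc)
open import Data.Nat.Properties using (suc-injective; 0≢1+n)
open import Data.Product using (∃-syntax; _,_; proj₁; proj₂)
open import Function using (_∘_)
open import Relation.Binary.Definitions using (DecidableEquality)
open import Relation.Binary.PropositionalEquality using (_≡_; _≗_; refl; sym; trans; cong; module ≡-Reasoning)
open import Relation.Nullary using (yes; no; does; contradiction)
open import Relation.Unary using (Pred; Decidable)

module _ {a b p} {A : Set a} {B : Set b} {P : Pred B p} (P? : Decidable P) where

  length-filter-map : (f : A → B) (xs : List A) →
                      length (filter (P? ∘ f) xs) ≡ length (filter P? (map f xs))
  length-filter-map f []       = refl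
  length-filter-map f (x ∷ xs) with does (P? (f x))
  ... | true  = cong suc (length-filter-map f xs)
  ... | false = length-filter-map f xs

module _ {a b} {A : Set a} {B : Set b} {f g : A → B} where

  map-≡⇒≡ : ∀ {x xs} → map f xs ≡ map g xs → x ∈ xs → f x ≡ g x
  map-≡⇒≡ eq (here refl)  = proj₁ (∷-injective eq)
  map-≡⇒≡ eq (there x∈xs) = map-≡⇒≡ (proj₂ (∷-injective eq)) x∈xs

module Multiplicity {a} {A : Set a} (_≟ᴬ_ : DecidableEquality A) where

  multiplicity : A → List A → ℕ
  multiplicity x xs = length (filter (_≟ᴬ x) xs)

  multiplicity-self : ∀ x xs → multiplicity x (x ∷ xs) ≡ suc (multiplicity x xs)
  multiplicity-self x xs with x ≟ᴬ x
  ... | yes _  = refl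
  ... | no x≢x = contradiction refl x≢x

  multiplicity-∷-cancel : ∀ {x y} xs ys →
    multiplicity y (x ∷ xs) ≡ multiplicity y (x ∷ ys) → multiplicity y xs ≡ multiplicity y ys
  multiplicity-∷-cancel {x} {y} xs ys eq with x ≟ᴬ y
  ... | yes _ = suc-injective eq
  ... | no _  = eq

  multiplicity-suc⇒∈ : ∀ {x n} ys → multiplicity x ys ≡ suc n → x ∈ ys
  multiplicity-suc⇒∈ {x} (y ∷ ys) eq with y ≟ᴬ x
  ... | yes y≡x = here (sym y≡x)
  ... | no _    = there (multiplicity-suc⇒∈ ys eq)

  multiplicity-↭ : ∀ x {xs ys} → xs ↭ ys → multiplicity x xs ≡ multiplicity x ys
  multiplicity-↭ x xs↭ys = ↭-length (filter-↭ (_≟ᴬ x) xs↭ys)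

  sameMultiplicities⇒↭ : ∀ xs ys → (∀ z → multiplicity z xs ≡ multiplicity z ys) → xs ↭ ys
  sameMultiplicities⇒↭ []       []       same = refl
  sameMultiplicities⇒↭ []       (y ∷ ys) same = contradiction (trans (same y) (multiplicity-self y ys)) 0≢1+n
  sameMultiplicities⇒↭ (x ∷ xs) ys       same
    with us , vs , refl ← ∈-∃++ (multiplicity-suc⇒∈ ys (trans (sym (same x)) (multiplicity-self x xs)))
    = ↭-trans (prep x (sameMultiplicities⇒↭ xs (us ++ vs) same′)) (↭-sym (shift x us vs))
    where
    same′ : ∀ z → multiplicity z xs ≡ multiplicity z (us ++ vs)
    same′ z = multiplicity-∷-cancel xs (us ++ vs) (trans (same z) (multiplicity-↭ z (shift x us vs)))

module _ {a} {A : Set a} where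

  swapAt : ℕ → List A → List A
  swapAt k       []           = []
  swapAt k       (x ∷ [])     = x ∷ []
  swapAt zero    (x ∷ y ∷ xs) = y ∷ x ∷ xs
  swapAt (suc k) (x ∷ y ∷ xs) = x ∷ swapAt k (y ∷ xs)

  swapsAt : List ℕ → List A → List A
  swapsAt []       xs = xs
  swapsAt (k ∷ ks) xs = swapsAt ks (swapAt k xs)

  swapAt-suc : ∀ k x xs → swapAt (suc k) (x ∷ xs) ≡ x ∷ swapAt k xs
  swapAt-suc k x []       = refl
  swapAt-suc k x (y ∷ xs) = refl

  swapsAt-++ : ∀ ks ls xs → swapsAt (ks ++ ls) xs ≡ swapsAt ls (swapsAt ks xs)
  swapsAt-++ []       ls xs = refl
  swapsAt-++ (k ∷ ks) ls xs = swapsAt-++ ks ls (swapAt k xs)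

  swapsAt-map-suc : ∀ ks x xs → swapsAt (map suc ks) (x ∷ xs) ≡ x ∷ swapsAt ks xs
  swapsAt-map-suc []       x xs = refl
  swapsAt-map-suc (k ∷ ks) x xs
    rewrite swapAt-suc k x xs = swapsAt-map-suc ks x (swapAt k xs)

  ↭⇒swapsAt : ∀ {xs ys} → xs ↭ ys → ∃[ ks ] swapsAt ks xs ≡ ys
  ↭⇒swapsAt refl = [] , refl
  ↭⇒swapsAt {x ∷ xs} (prep x p) =
    let ks , eq = ↭⇒swapsAt p
    in map suc ks , trans (swapsAt-map-suc ks x xs) (cong (x ∷_) eq)
  ↭⇒swapsAt {x ∷ y ∷ xs} (swap x y p) =
    let ks , eq = ↭⇒swapsAt p
    in zero ∷ map suc (map suc ks) ,
       trans (swapsAt-map-suc (map suc ks) y (x ∷ xs))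
             (cong (y ∷_) (trans (swapsAt-map-suc ks x xs) (cong (x ∷_) eq)))
  ↭⇒swapsAt {xs} (↭.trans p q) =
    let ks , eq = ↭⇒swapsAt p ; ls , eq′ = ↭⇒swapsAt q
    in ks ++ ls , trans (swapsAt-++ ks ls xs) (trans (cong (swapsAt ls) eq) eq′)

open Multiplicity (_≟_ {4})

colors : Coloring → List Color
colors f = map f (allFin 12)

count≡multiplicity : ∀ f c → count f c ≡ multiplicity c (colors f)
count≡multiplicity f c = length-filter-map (_≟ c) f (allFin 12)

colors-injective : ∀ {f g} → colors f ≡ colors g → f ≗ g
colors-injective {f} {g} eq e = map-≡⇒≡ {f = f} {g} eq (∈-allFin e)

applyMoves-++ : ∀ ms ns f → applyMoves (ms ++ ns) f ≡ applyMoves ns (applyMoves ms f)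
applyMoves-++ []       ns f = refl
applyMoves-++ (m ∷ ms) ns f = applyMoves-++ ms ns (move m f)

-- Each move has order 4.
inverse : List (Fin 4) → List (Fin 4)
inverse = reverse ∘ concatMap (λ m → m ∷ m ∷ m ∷ [])

conjugate : List (Fin 4) → List (Fin 4) → List (Fin 4)
conjugate w t = w ++ t ++ inverse w

-- For squares a, b sharing an edge this word is a transposition of two edges;
-- e.g. twist 0F 1F exchanges the edges with indices 1 and 2.
twist : Fin 4 → Fin 4 → List (Fin 4)
twist a b = concat (replicate 4 (a ∷ a ∷ b ∷ [])) ++ [ b ]

swapMoves : ℕ → List (Fin 4)
swapMoves 0  = conjugate (inverse [ 0F ]) (twist 0F 1F)
swapMoves 1  = twist 0F 1F
swapMoves 2  = conjugate [ 1F ] (twist 0F 1F)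
swapMoves 3  = conjugate [ 0F ] (twist 1F 0F)
swapMoves 4  = twist 1F 0F
swapMoves 5  = conjugate (inverse [ 1F ]) (twist 1F 0F)
swapMoves 6  = twist 2F 3F
swapMoves 7  = conjugate [ 3F ] (twist 2F 3F)
swapMoves 8  = conjugate [ 2F ] (twist 3F 2F)
swapMoves 9  = twist 3F 2F
swapMoves 10 = conjugate (inverse [ 3F ]) (twist 3F 2F)
swapMoves _  = []

colors-swapMoves : ∀ k f → colors (applyMoves (swapMoves k) f) ≡ swapAt k (colors f)
colors-swapMoves 0  f = refl
colors-swapMoves 1  f = refl
colors-swapMoves 2  f = refl
colors-swapMoves 3  f = refl
colors-swapMoves 4  f = refl
colors-swapMoves 5  f = refl
colors-swapMoves 6  f = refl
colors-swapMoves 7  f = refl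
colors-swapMoves 8  f = refl
colors-swapMoves 9  f = refl
colors-swapMoves 10 f = refl
colors-swapMoves (suc (suc (suc (suc (suc (suc (suc (suc (suc (suc (suc k))))))))))) f = refl

colors-concatMap-swapMoves : ∀ ks f → colors (applyMoves (concatMap swapMoves ks) f) ≡ swapsAt ks (colors f)
colors-concatMap-swapMoves []       f = refl
colors-concatMap-swapMoves (k ∷ ks) f = begin
  colors (applyMoves (swapMoves k ++ concatMap swapMoves ks) f)
    ≡⟨ cong colors (applyMoves-++ (swapMoves k) (concatMap swapMoves ks) f) ⟩
  colors (applyMoves (concatMap swapMoves ks) (applyMoves (swapMoves k) f))
    ≡⟨ colors-concatMap-swapMoves ks (applyMoves (swapMoves k) f) ⟩
  swapsAt ks (colors (applyMoves (swapMoves k) f))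
    ≡⟨ cong (swapsAt ks) (colors-swapMoves k f) ⟩
  swapsAt ks (swapAt k (colors f)) ∎
  where open ≡-Reasoning

sameCounts⇒reachable : ∀ f g → (∀ c → count f c ≡ count g c) →
                       ∃[ ms ] applyMoves ms f ≗ g
sameCounts⇒reachable f g same =
  let ks , eq = ↭⇒swapsAt (sameMultiplicities⇒↭ (colors f) (colors g) sameColors)
  in concatMap swapMoves ks , colors-injective (trans (colors-concatMap-swapMoves ks f) eq)
  where
  sameColors : ∀ c → multiplicity c (colors f) ≡ multiplicity c (colors g)
  sameColors c = trans (sym (count≡multiplicity f c)) (trans (same c) (count≡multiplicity g c))

mainTheorem1 : (f g : Coloring) → IsConfiguration f → IsConfiguration g →
    ∃[ ms ] ((e : Edge) → applyMoves ms f e ≡ g e)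
mainTheorem1 f g hf hg = sameCounts⇒reachable f g (λ c → trans (hf c) (sym (hg c)))
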